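{- Let $\ell$ be a positive integer. For each divisor $\lambda$ of $\ell$, let $\pi_\lambda=\pi(\lambda)\setminus\pi(\ell/\lambda)$ and $\pi'_\lambda=\pi(\ell/\lambda)$. Then $$\ell=\sum_{\substack{\lambda\mid\ell\\ \lambda_2<\max\{\ell_2,2\}}}2^{|\pi'_\lambda|}\,\phi(\lambda)\prod_{p\in\pi_\lambda}\frac{p-2}{p-1}.$$
   Context: $\pi(n)$ denotes the set of prime divisors of $n$, $\phi$ is Euler's totient function, and $x_2$ denotes the $2$-part (largest power of $2$ dividing) of an integer $x$. -}

module Defs where

open import Data.Nat as ℕ using (ℕ; zero; suc; _*_; _^_; _⊔_; _<_; _∸_; NonZero)
open import Data.Nat.DivMod using (_/_)
open import Data.Nat.Divisibility using (_∣_; _∣?_)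
open import Data.Nat.Primality using (Prime; prime?)
open import Data.Nat.Coprimality using (Coprime; coprime?)
open import Data.Nat.GCD using (gcd)
open import Data.List using (List; []; _∷_; filter; map; upTo; length; foldr)
open import Data.Integer using (+_)
open import Data.Rational as ℚ using (ℚ)
open import Relation.Nullary using (¬?; Dec; yes; no)
open import Relation.Nullary.Decidable using (_×-dec_)
open import Data.Bool using (if_then_else_)

oneTo : ℕ → List ℕ
oneTo n = map suc (upTo n)

divisors : ℕ → List ℕ
divisors n = filter (_∣? n) (oneTo n)

primeDivisors : ℕ → List ℕ
primeDivisors n = filter (λ p → prime? p ×-dec (p ∣? n)) (oneTo n)

φ : ℕ → ℕ
φ n = length (filter (λ k → coprime? k n) (oneTo n))

-- cofactor ℓ / λ (λ a positive divisor); quotient by 0 set to 0 (never used)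
cofactor : ℕ → ℕ → ℕ
cofactor ℓ zero = zero
cofactor ℓ (suc k) = ℓ / suc k

-- 2-adic valuation with fuel; v₂ n n is the exact valuation for n > 0
v₂ : ℕ → ℕ → ℕ
v₂ zero n = zero
v₂ (suc f) zero = zero
v₂ (suc f) (suc m) with 2 ∣? suc m
... | yes _ = suc (v₂ f (suc m / 2))
... | no _ = zero

twoPart : ℕ → ℕ
twoPart x = 2 ^ v₂ x x

piLam : ℕ → ℕ → List ℕ
piLam ℓ λ' = filter (λ p → ¬? (p ∣? cofactor ℓ λ')) (primeDivisors λ')

piLam' : ℕ → ℕ → List ℕ
piLam' ℓ λ' = primeDivisors (cofactor ℓ λ')

-- the rational (p-2)/(p-1); p is always a prime (≥ 2) where used
ratio : ℕ → ℚ
ratio (suc (suc k)) = (+ k) ℚ./ suc k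
ratio _ = ℚ.0ℚ

prodℚ : List ℚ → ℚ
prodℚ = foldr ℚ._*_ ℚ.1ℚ

sumℚ : List ℚ → ℚ
sumℚ = foldr ℚ._+_ ℚ.0ℚ

fromℕ : ℕ → ℚ
fromℕ n = (+ n) ℚ./ 1

term : ℕ → ℕ → ℚ
term ℓ λ' = fromℕ (2 ^ length (piLam' ℓ λ') * φ λ') ℚ.* prodℚ (map ratio (piLam ℓ λ'))

indexSet : ℕ → List ℕ
indexSet ℓ = filter (λ λ' → ℕ._<?_ (twoPart λ') (twoPart ℓ ⊔ 2)) (divisors ℓ)

rhs : ℕ → ℚ
rhs ℓ = sumℚ (map (term ℓ) (indexSet ℓ))

{-# OPTIONS --safe #-}
-- Write S(ℓ) for the sum of the summands over all divisors λ of ℓ. The condition λ₂ < max{ℓ₂, 2}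
-- only discards vanishing summands: when it fails, 2 divides λ but not ℓ/λ, so 2 ∈ π_λ and the
-- factor (2-2)/(2-1) is 0. For a prime p ∤ m the divisors of p^e m are the p^j μ with j ≤ e and
-- μ ∣ m, and the summand of p^j μ in S(p^e m) is that of μ in S(m) times 2φ(p^j) if j < e (p joins
-- π'_λ) and times φ(p^e)(p-2)/(p-1) if j = e (p joins π_λ). Since Σ_{j<e} 2φ(p^j) = 2p^(e-1) and
-- φ(p^e)(p-2)/(p-1) = p^(e-1)(p-2), this gives S(p^e m) = p^e S(m), and S(ℓ) = ℓ by induction.
module Submission where

open import Defs
open import Data.Nat using (ℕ; _<_)
open import Relation.Binary.PropositionalEquality using (_≡_)

open import Algebra.Bundles using (CommutativeMonoid)
import Algebra.Properties.CommutativeSemigroup as CommSemigroupProperties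
import Data.Integer as ℤ
import Data.Integer.Properties as ℤₚ
import Data.Integer.Tactic.RingSolver as ℤ-RingSolver
open import Data.List
  using (List; []; _∷_; [_]; _++_; _∷ʳ_; map; filter; length; upTo; applyUpTo; cartesianProduct)
import Data.List.Properties as List
open import Data.List.Membership.Propositional using (_∈_)
open import Data.List.Membership.Propositional.Properties
  using ( ∈-map⁺; ∈-map⁻; ∈-filter⁺; ∈-filter⁻; ∈-upTo⁺; ∈-upTo⁻
        ; ∈-cartesianProduct⁺; ∈-cartesianProduct⁻)
open import Data.List.Membership.Propositional.Properties.WithK using (unique∧set⇒bag)
open import Data.List.Relation.Binary.BagAndSetEquality using (∼bag⇒↭)
open import Data.List.Relation.Binary.Permutation.Propositional using (_↭_; ↭⇒↭ₛ)
import Data.List.Relation.Binary.Permutation.Propositional.Properties as ↭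
open import Data.List.Relation.Binary.Permutation.Setoid.Properties using (foldr-commMonoid)
import Data.List.Relation.Unary.All as All
import Data.List.Relation.Unary.All.Properties as All
open import Data.List.Relation.Unary.AllPairs using ([]; _∷_)
open import Data.List.Relation.Unary.Any using (here; there)
open import Data.List.Relation.Unary.Unique.Propositional using (Unique)
import Data.List.Relation.Unary.Unique.Propositional.Properties as Unique
open import Data.Nat.Base
  using ( zero; suc; _+_; _*_; _∸_; _^_; _≤_; _⊔_; z≤n; s≤s; z<s; s<s
        ; NonZero; NonTrivial; >-nonZero; >-nonZero⁻¹; nonTrivial⇒n>1; nonTrivial⇒≢1)
import Data.Nat.Properties as ℕₚ
open import Data.Nat.Properties using (_<?_; _≟_)
open import Data.Nat.Coprimality as Coprime using (Coprime; coprime?; coprime-divisor)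
open import Data.Nat.DivMod using (_/_; m/n*n≡m; m*n/n≡m; m/n<m)
open import Data.Nat.Divisibility
  using ( _∣_; _∣?_; divides; 1∣_; ∣⇒≤; ∣-trans; ∣-refl; ∣1⇒≡1; ∣m+n∣m⇒∣n; ∣m∣n⇒∣m+n
        ; n∣m*n; m∣m*n; ∣n⇒∣m*n; *-pres-∣; *-cancelˡ-∣)
open import Data.Nat.Induction using (<-rec)
open import Data.Nat.Primality using (Prime; prime?; prime[2]; prime⇒nonZero; prime⇒nonTrivial; prime⇒irreducible)
open import Data.Nat.Primality.Factorisation using (factorise)
open import Data.Nat.Tactic.RingSolver using (solve-∀)
open import Data.Product using (∃; ∃₂; _×_; _,_; proj₁; proj₂; uncurry)
open import Data.Rational as ℚ using (ℚ; 0ℚ; fromℚᵘ)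
import Data.Rational.Properties as ℚₚ
open import Data.Rational.Unnormalised as ℚᵘ using (mkℚᵘ; *≡*)
import Data.Rational.Unnormalised.Properties as ℚᵘₚ
open import Data.Sum using (inj₁; inj₂)
open import Function using (_∘_; mk⇔)
open import Relation.Binary.PropositionalEquality using (refl; sym; trans; cong; cong₂; subst; _≢_; module ≡-Reasoning)
open import Relation.Nullary using (¬_; Dec; yes; no; ¬?; contradiction)
open import Relation.Nullary.Decidable using (_×-dec_)
open import Relation.Unary using (Decidable)

private
  variable
    A B C : Set

indicator : Dec A → ℕ
indicator (yes _) = 1
indicator (no _)  = 0

indicator-yes : (a? : Dec A) → A → indicator a? ≡ 1
indicator-yes (yes _) _ = refl
indicator-yes (no ¬a) a = contradiction a ¬a

indicator-no : (a? : Dec A) → ¬ A → indicator a? ≡ 0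
indicator-no (yes a) ¬a = contradiction a ¬a
indicator-no (no _)  _  = refl

indicator-⇔ : (a? : Dec A) (b? : Dec B) → (A → B) → (B → A) → indicator a? ≡ indicator b?
indicator-⇔ (yes a) b? f g = sym (indicator-yes b? (f a))
indicator-⇔ (no ¬a) b? f g = sym (indicator-no b? (¬a ∘ g))

indicator-split : (a? : Dec A) (b? : Dec B) (c? : Dec C) → (A → B) → (A → ¬ C) → (B → ¬ C → A) →
                  indicator b? ≡ indicator a? + indicator c? * indicator b?
indicator-split (yes a) (yes b) (yes c) a⇒b a⇒¬c b∧¬c⇒a = contradiction c (a⇒¬c a)
indicator-split (yes a) (yes b) (no ¬c) a⇒b a⇒¬c b∧¬c⇒a = refl
indicator-split (yes a) (no ¬b) c?      a⇒b a⇒¬c b∧¬c⇒a = contradiction (a⇒b a) ¬b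
indicator-split (no ¬a) (yes b) (yes c) a⇒b a⇒¬c b∧¬c⇒a = refl
indicator-split (no ¬a) (yes b) (no ¬c) a⇒b a⇒¬c b∧¬c⇒a = contradiction (b∧¬c⇒a b ¬c) ¬a
indicator-split (no ¬a) (no ¬b) (yes c) a⇒b a⇒¬c b∧¬c⇒a = refl
indicator-split (no ¬a) (no ¬b) (no ¬c) a⇒b a⇒¬c b∧¬c⇒a = refl

sumBelow : ℕ → (ℕ → ℕ) → ℕ
sumBelow zero    f = 0
sumBelow (suc n) f = f 0 + sumBelow n (f ∘ suc)

sumBelow-cong : ∀ n {f g} → (∀ i → i < n → f i ≡ g i) → sumBelow n f ≡ sumBelow n g
sumBelow-cong zero    eq = refl
sumBelow-cong (suc n) eq = cong₂ _+_ (eq 0 z<s) (sumBelow-cong n (λ i i<n → eq (suc i) (s<s i<n)))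

sumBelow-zero : ∀ n {f} → (∀ i → i < n → f i ≡ 0) → sumBelow n f ≡ 0
sumBelow-zero zero    eq = refl
sumBelow-zero (suc n) eq = cong₂ _+_ (eq 0 z<s) (sumBelow-zero n (λ i i<n → eq (suc i) (s<s i<n)))

sumBelow-+ : ∀ m n f → sumBelow (m + n) f ≡ sumBelow m f + sumBelow n (λ i → f (m + i))
sumBelow-+ zero    n f = refl
sumBelow-+ (suc m) n f = trans (cong (f 0 +_) (sumBelow-+ m n (f ∘ suc))) (sym (ℕₚ.+-assoc (f 0) _ _))

sumBelow-suc : ∀ n f → sumBelow (suc n) f ≡ sumBelow n f + f n
sumBelow-suc zero    f = ℕₚ.+-identityʳ (f 0)
sumBelow-suc (suc n) f = trans (cong (f 0 +_) (sumBelow-suc n (f ∘ suc))) (sym (ℕₚ.+-assoc (f 0) _ _))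

sumBelow-distrib-+ : ∀ n f g → sumBelow n (λ i → f i + g i) ≡ sumBelow n f + sumBelow n g
sumBelow-distrib-+ zero    f g = refl
sumBelow-distrib-+ (suc n) f g =
  trans (cong (f 0 + g 0 +_) (sumBelow-distrib-+ n (f ∘ suc) (g ∘ suc))) (+-interchange (f 0) (g 0) _ _)
  where open CommSemigroupProperties ℕₚ.+-commutativeSemigroup renaming (interchange to +-interchange)

sumBelow-*ˡ : ∀ a n f → sumBelow n (λ i → a * f i) ≡ a * sumBelow n f
sumBelow-*ˡ a zero    f = sym (ℕₚ.*-zeroʳ a)
sumBelow-*ˡ a (suc n) f = trans (cong (a * f 0 +_) (sumBelow-*ˡ a n (f ∘ suc))) (sym (ℕₚ.*-distribˡ-+ a (f 0) _))

sumBelow-periodic : ∀ μ f → (∀ i → f (μ + i) ≡ f i) → ∀ a → sumBelow (a * μ) f ≡ a * sumBelow μ f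
sumBelow-periodic μ f periodic zero    = refl
sumBelow-periodic μ f periodic (suc a) = begin
  sumBelow (μ + a * μ) f
    ≡⟨ sumBelow-+ μ (a * μ) f ⟩
  sumBelow μ f + sumBelow (a * μ) (λ i → f (μ + i))
    ≡⟨ cong (sumBelow μ f +_) (sumBelow-cong (a * μ) (λ i _ → periodic i)) ⟩
  sumBelow μ f + sumBelow (a * μ) f
    ≡⟨ cong (sumBelow μ f +_) (sumBelow-periodic μ f periodic a) ⟩
  sumBelow μ f + a * sumBelow μ f ∎
  where open ≡-Reasoning

sumBelow-multiples : ∀ p .{{_ : NonZero p}} M (g : ℕ → ℕ) →
  sumBelow (M * p) (λ i → indicator (p ∣? suc i) * g (suc i)) ≡ sumBelow M (λ t → g (p * suc t))
sumBelow-multiples p         zero    g = refl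
sumBelow-multiples p@(suc p') (suc M) g = begin
  sumBelow (p + M * p) f
    ≡⟨ sumBelow-+ p (M * p) f ⟩
  sumBelow p f + sumBelow (M * p) (λ i → f (p + i))
    ≡⟨ cong₂ _+_ first-block (sumBelow-cong (M * p) shift) ⟩
  g (p * 1) + sumBelow (M * p) (λ i → indicator (p ∣? suc i) * g (p + suc i))
    ≡⟨ cong (g (p * 1) +_) (sumBelow-multiples p M (λ k → g (p + k))) ⟩
  g (p * 1) + sumBelow M (λ t → g (p + p * suc t))
    ≡⟨ cong (g (p * 1) +_) (sumBelow-cong M (λ t _ → cong g (ℕₚ.*-suc p (suc t)))) ⟨
  g (p * 1) + sumBelow M (λ t → g (p * suc (suc t))) ∎
  where
  open ≡-Reasoning
  f : ℕ → ℕ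
  f i = indicator (p ∣? suc i) * g (suc i)
  first-block : sumBelow p f ≡ g (p * 1)
  first-block = begin
    sumBelow (suc p') f   ≡⟨ sumBelow-suc p' f ⟩
    sumBelow p' f + f p'  ≡⟨ cong₂ _+_ (sumBelow-zero p' no-multiple) last ⟩
    g (p * 1)             ∎
    where
    no-multiple : ∀ i → i < p' → f i ≡ 0
    no-multiple i i<p' =
      cong (λ b → b * g (suc i)) (indicator-no (p ∣? suc i) (λ p∣ → ℕₚ.<⇒≱ (s<s i<p') (∣⇒≤ p∣)))
    last : f p' ≡ g (p * 1)
    last = begin
      indicator (p ∣? p) * g p  ≡⟨ cong (λ b → b * g p) (indicator-yes (p ∣? p) ∣-refl) ⟩
      1 * g p                   ≡⟨ ℕₚ.*-identityˡ (g p) ⟩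
      g p                       ≡⟨ cong g (ℕₚ.*-identityʳ p) ⟨
      g (p * 1)                 ∎
  shift : ∀ i → i < M * p → f (p + i) ≡ indicator (p ∣? suc i) * g (p + suc i)
  shift i _ = cong₂ _*_
    (indicator-⇔ (p ∣? suc (p + i)) (p ∣? suc i)
                 (λ p∣ → ∣m+n∣m⇒∣n (subst (p ∣_) (sym (ℕₚ.+-suc p i)) p∣) ∣-refl)
                 (λ p∣ → subst (p ∣_) (ℕₚ.+-suc p i) (∣m∣n⇒∣m+n ∣-refl p∣)))
    (cong g (sym (ℕₚ.+-suc p i)))

length-filter-applyUpTo : {P : ℕ → Set} (P? : Decidable P) (f : ℕ → ℕ) (n : ℕ) →
  length (filter P? (applyUpTo f n)) ≡ sumBelow n (λ i → indicator (P? (f i)))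
length-filter-applyUpTo P? f zero = refl
length-filter-applyUpTo P? f (suc n) with P? (f 0)
... | yes _ = cong suc (length-filter-applyUpTo P? (f ∘ suc) n)
... | no  _ = length-filter-applyUpTo P? (f ∘ suc) n

unique∧sameElements⇒↭ : {xs ys : List A} → Unique xs → Unique ys →
  (∀ {z} → z ∈ xs → z ∈ ys) → (∀ {z} → z ∈ ys → z ∈ xs) → xs ↭ ys
unique∧sameElements⇒↭ xs! ys! to from = ∼bag⇒↭ (unique∧set⇒bag xs! ys! (mk⇔ to from))

Unique-map⁺-local : {f : A → B} {xs : List A} →
  (∀ {x y} → x ∈ xs → y ∈ xs → f x ≡ f y → x ≡ y) → Unique xs → Unique (map f xs)
Unique-map⁺-local {xs = []}     inj []         = []
Unique-map⁺-local {xs = x ∷ xs} inj (x∉ ∷ xs!) =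
  All.map⁺ (All.tabulate (λ y∈ fx≡fy → All.lookup x∉ y∈ (inj (here refl) (there y∈) fx≡fy)))
  ∷ Unique-map⁺-local (λ x∈ y∈ → inj (there x∈) (there y∈)) xs!

sumℚ-↭ : {xs ys : List ℚ} → xs ↭ ys → sumℚ xs ≡ sumℚ ys
sumℚ-↭ xs↭ys = foldr-commMonoid (CommutativeMonoid.setoid ℚₚ.+-0-commutativeMonoid)
                                ℚₚ.+-0-isCommutativeMonoid (↭⇒↭ₛ xs↭ys)

prodℚ-↭ : {xs ys : List ℚ} → xs ↭ ys → prodℚ xs ≡ prodℚ ys
prodℚ-↭ xs↭ys = foldr-commMonoid (CommutativeMonoid.setoid ℚₚ.*-1-commutativeMonoid)
                                 ℚₚ.*-1-isCommutativeMonoid (↭⇒↭ₛ xs↭ys)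

sumℚ-++ : ∀ xs ys → sumℚ (xs ++ ys) ≡ sumℚ xs ℚ.+ sumℚ ys
sumℚ-++ []       ys = sym (ℚₚ.+-identityˡ (sumℚ ys))
sumℚ-++ (x ∷ xs) ys = trans (cong (x ℚ.+_) (sumℚ-++ xs ys)) (sym (ℚₚ.+-assoc x (sumℚ xs) (sumℚ ys)))

sumℚ-∷ʳ : ∀ xs x → sumℚ (xs ∷ʳ x) ≡ sumℚ xs ℚ.+ x
sumℚ-∷ʳ xs x = trans (sumℚ-++ xs [ x ]) (cong (sumℚ xs ℚ.+_) (ℚₚ.+-identityʳ x))

sumℚ-map-cong : {f g : A → ℚ} (xs : List A) → (∀ {x} → x ∈ xs → f x ≡ g x) →
                sumℚ (map f xs) ≡ sumℚ (map g xs)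
sumℚ-map-cong xs f≡g = cong sumℚ (List.map-cong-local (All.tabulate f≡g))

sumℚ-map-*ˡ : ∀ a (f : A → ℚ) (xs : List A) → sumℚ (map (λ x → a ℚ.* f x) xs) ≡ a ℚ.* sumℚ (map f xs)
sumℚ-map-*ˡ a f []       = sym (ℚₚ.*-zeroʳ a)
sumℚ-map-*ˡ a f (x ∷ xs) =
  trans (cong (a ℚ.* f x ℚ.+_) (sumℚ-map-*ˡ a f xs)) (sym (ℚₚ.*-distribˡ-+ a (f x) _))

sumℚ-map-*ʳ : ∀ a (f : A → ℚ) (xs : List A) → sumℚ (map (λ x → f x ℚ.* a) xs) ≡ sumℚ (map f xs) ℚ.* a
sumℚ-map-*ʳ a f []       = sym (ℚₚ.*-zeroˡ a)
sumℚ-map-*ʳ a f (x ∷ xs) =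
  trans (cong (f x ℚ.* a ℚ.+_) (sumℚ-map-*ʳ a f xs)) (sym (ℚₚ.*-distribʳ-+ a (f x) _))

sumℚ-cartesianProduct : ∀ (F : A → B → ℚ) (xs : List A) (ys : List B) →
  sumℚ (map (uncurry F) (cartesianProduct xs ys)) ≡ sumℚ (map (λ x → sumℚ (map (F x) ys)) xs)
sumℚ-cartesianProduct F []       ys = refl
sumℚ-cartesianProduct F (x ∷ xs) ys = begin
  sumℚ (map (uncurry F) (map (x ,_) ys ++ cartesianProduct xs ys))
    ≡⟨ cong sumℚ (List.map-++ (uncurry F) (map (x ,_) ys) _) ⟩
  sumℚ (map (uncurry F) (map (x ,_) ys) ++ map (uncurry F) (cartesianProduct xs ys))
    ≡⟨ sumℚ-++ (map (uncurry F) (map (x ,_) ys)) _ ⟩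
  sumℚ (map (uncurry F) (map (x ,_) ys)) ℚ.+ sumℚ (map (uncurry F) (cartesianProduct xs ys))
    ≡⟨ cong₂ ℚ._+_ (cong sumℚ (sym (List.map-∘ ys))) (sumℚ-cartesianProduct F xs ys) ⟩
  sumℚ (map (F x) ys) ℚ.+ sumℚ (map (λ x → sumℚ (map (F x) ys)) xs) ∎
  where open ≡-Reasoning

sumℚ-map-filter : {P : A → Set} (P? : Decidable P) (f : A → ℚ) (xs : List A) →
  (∀ {x} → x ∈ xs → ¬ P x → f x ≡ 0ℚ) → sumℚ (map f (filter P? xs)) ≡ sumℚ (map f xs)
sumℚ-map-filter P? f []       vanish = refl
sumℚ-map-filter P? f (x ∷ xs) vanish with P? x
... | yes _  = cong (f x ℚ.+_) (sumℚ-map-filter P? f xs (vanish ∘ there))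
... | no ¬Px = begin
  sumℚ (map f (filter P? xs))   ≡⟨ sumℚ-map-filter P? f xs (vanish ∘ there) ⟩
  sumℚ (map f xs)               ≡⟨ ℚₚ.+-identityˡ (sumℚ (map f xs)) ⟨
  0ℚ ℚ.+ sumℚ (map f xs)        ≡⟨ cong (ℚ._+ sumℚ (map f xs)) (vanish (here refl) ¬Px) ⟨
  f x ℚ.+ sumℚ (map f xs)       ∎
  where open ≡-Reasoning

prodℚ-map-zero : ∀ (f : A → ℚ) {x} (xs : List A) → x ∈ xs → f x ≡ 0ℚ → prodℚ (map f xs) ≡ 0ℚ
prodℚ-map-zero f (y ∷ ys) (here refl) fx≡0 = trans (cong (ℚ._* prodℚ (map f ys)) fx≡0) (ℚₚ.*-zeroˡ (prodℚ (map f ys)))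
prodℚ-map-zero f (y ∷ ys) (there x∈)  fx≡0 = trans (cong (f y ℚ.*_) (prodℚ-map-zero f ys x∈ fx≡0)) (ℚₚ.*-zeroʳ (f y))

fromℚᵘ-homo-+ : ∀ p q → fromℚᵘ (p ℚᵘ.+ q) ≡ fromℚᵘ p ℚ.+ fromℚᵘ q
fromℚᵘ-homo-+ p q = ℚₚ.toℚᵘ-injective (ℚᵘₚ.≃-trans (ℚₚ.toℚᵘ-fromℚᵘ (p ℚᵘ.+ q))
  (ℚᵘₚ.≃-sym (ℚᵘₚ.≃-trans (ℚₚ.toℚᵘ-homo-+ (fromℚᵘ p) (fromℚᵘ q))
                          (ℚᵘₚ.+-cong (ℚₚ.toℚᵘ-fromℚᵘ p) (ℚₚ.toℚᵘ-fromℚᵘ q)))))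

fromℚᵘ-homo-* : ∀ p q → fromℚᵘ (p ℚᵘ.* q) ≡ fromℚᵘ p ℚ.* fromℚᵘ q
fromℚᵘ-homo-* p q = ℚₚ.toℚᵘ-injective (ℚᵘₚ.≃-trans (ℚₚ.toℚᵘ-fromℚᵘ (p ℚᵘ.* q))
  (ℚᵘₚ.≃-sym (ℚᵘₚ.≃-trans (ℚₚ.toℚᵘ-homo-* (fromℚᵘ p) (fromℚᵘ q))
                          (ℚᵘₚ.*-cong (ℚₚ.toℚᵘ-fromℚᵘ p) (ℚₚ.toℚᵘ-fromℚᵘ q)))))

fromℕ-homo-+ : ∀ m n → fromℕ (m + n) ≡ fromℕ m ℚ.+ fromℕ n
fromℕ-homo-+ m n = trans (cong (λ z → fromℚᵘ (mkℚᵘ z 0)) numerator)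
                         (fromℚᵘ-homo-+ (mkℚᵘ (ℤ.+ m) 0) (mkℚᵘ (ℤ.+ n) 0))
  where
  numerator : ℤ.+ (m + n) ≡ ℤ.+ m ℤ.* ℤ.1ℤ ℤ.+ ℤ.+ n ℤ.* ℤ.1ℤ
  numerator = trans (ℤₚ.pos-+ m n) (sym (cong₂ ℤ._+_ (ℤₚ.*-identityʳ (ℤ.+ m)) (ℤₚ.*-identityʳ (ℤ.+ n))))

fromℕ-homo-* : ∀ m n → fromℕ (m * n) ≡ fromℕ m ℚ.* fromℕ n
fromℕ-homo-* m n = trans (cong (λ z → fromℚᵘ (mkℚᵘ z 0)) (ℤₚ.pos-* m n))
                         (fromℚᵘ-homo-* (mkℚᵘ (ℤ.+ m) 0) (mkℚᵘ (ℤ.+ n) 0))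

sumℚ-applyUpTo-fromℕ : ∀ f n → sumℚ (applyUpTo (λ j → fromℕ (f j)) n) ≡ fromℕ (sumBelow n f)
sumℚ-applyUpTo-fromℕ f zero    = refl
sumℚ-applyUpTo-fromℕ f (suc n) =
  trans (cong (fromℕ (f 0) ℚ.+_) (sumℚ-applyUpTo-fromℕ (f ∘ suc) n)) (sym (fromℕ-homo-+ (f 0) _))

sumℚ-map-fromℕ-upTo : ∀ f n → sumℚ (map (λ j → fromℕ (f j)) (upTo n)) ≡ fromℕ (sumBelow n f)
sumℚ-map-fromℕ-upTo f n = trans (cong sumℚ (List.map-upTo (λ j → fromℕ (f j)) n)) (sumℚ-applyUpTo-fromℕ f n)

fromℕ[p∸1]*ratio[p] : ∀ p .{{_ : NonTrivial p}} → fromℕ (p ∸ 1) ℚ.* ratio p ≡ fromℕ (p ∸ 2)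
fromℕ[p∸1]*ratio[p] (suc (suc k)) =
  trans (sym (fromℚᵘ-homo-* [1+k] [k/1+k])) (ℚₚ.fromℚᵘ-cong {[1+k] ℚᵘ.* [k/1+k]} {[k]} (*≡* (cross-multiply (ℤ.+ suc k) (ℤ.+ k))))
  where
  [1+k] = mkℚᵘ (ℤ.+ suc k) 0
  [k/1+k] = mkℚᵘ (ℤ.+ k) k
  [k] = mkℚᵘ (ℤ.+ k) 0
  cross-multiply : ∀ a b → a ℤ.* b ℤ.* ℤ.1ℤ ≡ b ℤ.* (ℤ.1ℤ ℤ.* a)
  cross-multiply = ℤ-RingSolver.solve-∀

-- Divisibility and coprimality

∣⇒0< : ∀ {d n} → 0 < n → d ∣ n → 0 < d
∣⇒0< {zero}  {suc n} _ (divides q eq) = contradiction (trans eq (ℕₚ.*-zeroʳ q)) (λ ())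
∣⇒0< {suc d}         _ _              = z<s

p∣p^[1+j]*n : ∀ p j n → p ∣ p ^ suc j * n
p∣p^[1+j]*n p j n = ∣-trans (m∣m*n (p ^ j)) (m∣m*n n)

^-∣ : ∀ p {j e} → j ≤ e → p ^ j ∣ p ^ e
^-∣ p {j} {e} j≤e = divides (p ^ (e ∸ j))
  (trans (cong (p ^_) (sym (ℕₚ.m∸n+n≡m j≤e))) (ℕₚ.^-distribˡ-+-* p (e ∸ j) j))

∃-prime-divisor : ∀ n → 1 < n → ∃ λ p → Prime p × p ∣ n
∃-prime-divisor 1 (s<s ())
∃-prime-divisor n@(suc (suc _)) _ with factorise n
... | record { factors = [] ; isFactorisation = () }
... | record { factors = p ∷ _ ; isFactorisation = n≡Π ; factorsPrime = p-prime All.∷ _ } =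
  p , p-prime , subst (p ∣_) (sym n≡Π) (m∣m*n _)

coprime-* : ∀ {k m n} → Coprime k m → Coprime k n → Coprime k (m * n)
coprime-* {m = m} k⊥m k⊥n {d} (d∣k , d∣m*n) = k⊥n (d∣k , coprime-divisor d⊥m d∣m*n)
  where
  d⊥m : Coprime d m
  d⊥m (e∣d , e∣m) = k⊥m (∣-trans e∣d d∣k , e∣m)

coprime-∣ʳ : ∀ {k m n} → Coprime k n → m ∣ n → Coprime k m
coprime-∣ʳ k⊥n m∣n (d∣k , d∣m) = k⊥n (d∣k , ∣-trans d∣m m∣n)

prime⇒≢1 : ∀ {p} → Prime p → p ≢ 1
prime⇒≢1 p-prime = nonTrivial⇒≢1 {{prime⇒nonTrivial p-prime}}

prime∤⇒coprime : ∀ {p k} → Prime p → ¬ p ∣ k → Coprime k p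
prime∤⇒coprime p-prime p∤k (d∣k , d∣p) with prime⇒irreducible p-prime d∣p
... | inj₁ d≡1  = d≡1
... | inj₂ refl = contradiction d∣k p∤k

prime∤⇒coprime-^ : ∀ {p k} → Prime p → ¬ p ∣ k → ∀ j → Coprime k (p ^ j)
prime∤⇒coprime-^ p-prime p∤k zero    (_ , d∣1) = ∣1⇒≡1 d∣1
prime∤⇒coprime-^ p-prime p∤k (suc j) = coprime-* (prime∤⇒coprime p-prime p∤k) (prime∤⇒coprime-^ p-prime p∤k j)

prime∤prime : ∀ {p q} → Prime p → Prime q → p ≢ q → ¬ p ∣ q
prime∤prime p-prime q-prime p≢q p∣q with prime⇒irreducible q-prime p∣q
... | inj₁ p≡1 = prime⇒≢1 p-prime p≡1
... | inj₂ p≡q = p≢q p≡q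

prime-∣-p^j*n : ∀ {p q n} j → Prime p → Prime q → q ≢ p → q ∣ p ^ j * n → q ∣ n
prime-∣-p^j*n j p-prime q-prime q≢p = coprime-divisor (prime∤⇒coprime-^ p-prime (prime∤prime p-prime q-prime (q≢p ∘ sym)) j)

∈-oneTo⁻ : ∀ {k n} → k ∈ oneTo n → 0 < k × k ≤ n
∈-oneTo⁻ k∈ with _ , i∈ , refl ← ∈-map⁻ suc k∈ = z<s , ∈-upTo⁻ i∈

∈-oneTo⁺ : ∀ {k n} → 0 < k → k ≤ n → k ∈ oneTo n
∈-oneTo⁺ {suc k} _ k<n = ∈-map⁺ suc (∈-upTo⁺ k<n)

Unique-oneTo : ∀ n → Unique (oneTo n)
Unique-oneTo n = Unique.map⁺ ℕₚ.suc-injective (Unique.upTo⁺ n)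

∈-divisors⁻ : ∀ {d n} → d ∈ divisors n → 0 < d × d ∣ n
∈-divisors⁻ {n = n} d∈ with d∈oneTo , d∣n ← ∈-filter⁻ (_∣? n) {xs = oneTo n} d∈ =
  proj₁ (∈-oneTo⁻ d∈oneTo) , d∣n

∈-divisors⁺ : ∀ {d n} → 0 < n → d ∣ n → d ∈ divisors n
∈-divisors⁺ {n = n} n>0 d∣n =
  ∈-filter⁺ (_∣? n) (∈-oneTo⁺ (∣⇒0< n>0 d∣n) (∣⇒≤ {{>-nonZero n>0}} d∣n)) d∣n

Unique-divisors : ∀ n → Unique (divisors n)
Unique-divisors n = Unique.filter⁺ (_∣? n) (Unique-oneTo n)

∈-primeDivisors⁻ : ∀ {q n} → q ∈ primeDivisors n → Prime q × q ∣ n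
∈-primeDivisors⁻ {n = n} q∈ = proj₂ (∈-filter⁻ (λ q → prime? q ×-dec q ∣? n) {xs = oneTo n} q∈)

∈-primeDivisors⁺ : ∀ {q n} → 0 < n → Prime q → q ∣ n → q ∈ primeDivisors n
∈-primeDivisors⁺ {n = n} n>0 q-prime q∣n = ∈-filter⁺ (λ q → prime? q ×-dec q ∣? n)
  (∈-oneTo⁺ (∣⇒0< n>0 q∣n) (∣⇒≤ {{>-nonZero n>0}} q∣n)) (q-prime , q∣n)

Unique-primeDivisors : ∀ n → Unique (primeDivisors n)
Unique-primeDivisors n = Unique.filter⁺ (λ q → prime? q ×-dec q ∣? n) (Unique-oneTo n)

-- For c = ℓ / d this is the paper's π_d = π(d) \ π(ℓ / d), i.e. piLam ℓ d.
primesOnlyIn : ℕ → ℕ → List ℕ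
primesOnlyIn d c = filter (λ q → ¬? (q ∣? c)) (primeDivisors d)

∈-primesOnlyIn⁻ : ∀ {q d c} → q ∈ primesOnlyIn d c → Prime q × q ∣ d × ¬ q ∣ c
∈-primesOnlyIn⁻ {d = d} {c} q∈ with q∈π[d] , q∤c ← ∈-filter⁻ (λ q → ¬? (q ∣? c)) {xs = primeDivisors d} q∈ =
  proj₁ (∈-primeDivisors⁻ {n = d} q∈π[d]) , proj₂ (∈-primeDivisors⁻ {n = d} q∈π[d]) , q∤c

∈-primesOnlyIn⁺ : ∀ {q d c} → 0 < d → Prime q → q ∣ d → ¬ q ∣ c → q ∈ primesOnlyIn d c
∈-primesOnlyIn⁺ {c = c} d>0 q-prime q∣d q∤c =
  ∈-filter⁺ (λ q → ¬? (q ∣? c)) (∈-primeDivisors⁺ d>0 q-prime q∣d) q∤c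

Unique-primesOnlyIn : ∀ d c → Unique (primesOnlyIn d c)
Unique-primesOnlyIn d c = Unique.filter⁺ (λ q → ¬? (q ∣? c)) (Unique-primeDivisors d)

summand : ℕ → ℕ → ℚ
summand d c = fromℕ (2 ^ length (primeDivisors c) * φ d) ℚ.* prodℚ (map ratio (primesOnlyIn d c))

term≡summand : ∀ ℓ d → term ℓ d ≡ summand d (cofactor ℓ d)
term≡summand ℓ d = refl

termSum : ℕ → ℚ
termSum ℓ = sumℚ (map (term ℓ) (divisors ℓ))

cofactor-unique : ∀ {ℓ d c} → 0 < d → c * d ≡ ℓ → cofactor ℓ d ≡ c
cofactor-unique {d = suc d'} {c} _ refl = m*n/n≡m c (suc d')

cofactor*d≡ℓ : ∀ {ℓ d} → 0 < d → d ∣ ℓ → cofactor ℓ d * d ≡ ℓ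
cofactor*d≡ℓ {d = suc _} _ d∣ℓ = m/n*n≡m d∣ℓ

cofactor-∣ : ∀ {ℓ d} → 0 < d → d ∣ ℓ → cofactor ℓ d ∣ ℓ
cofactor-∣ {ℓ} {d} d>0 d∣ℓ = divides d (trans (sym (cofactor*d≡ℓ d>0 d∣ℓ)) (ℕₚ.*-comm (cofactor ℓ d) d))

-- The 2-part

v₂-∣ : ∀ f n → 2 ^ v₂ f n ∣ n
v₂-∣ zero    n       = 1∣ n
v₂-∣ (suc f) zero    = 1∣ 0
v₂-∣ (suc f) (suc m) with 2 ∣? suc m
... | no  _   = 1∣ suc m
... | yes 2∣n = subst (2 * 2 ^ v₂ f (suc m / 2) ∣_) (trans (ℕₚ.*-comm 2 (suc m / 2)) (m/n*n≡m 2∣n))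
                      (*-pres-∣ (∣-refl {2}) (v₂-∣ f (suc m / 2)))

2^k∣⇒k≤v₂ : ∀ f {n} k → 0 < n → n ≤ f → 2 ^ k ∣ n → k ≤ v₂ f n
2^k∣⇒k≤v₂ f       zero    _   _         _ = z≤n
2^k∣⇒k≤v₂ (suc f) {suc m} (suc k) z<s (s≤s m≤f) 2^[1+k]∣n with 2 ∣? suc m
... | no  2∤n = contradiction (∣-trans (m∣m*n (2 ^ k)) 2^[1+k]∣n) 2∤n
... | yes 2∣n = s≤s (2^k∣⇒k≤v₂ f k half>0 half≤f 2^k∣half)
  where
  half*2 : suc m / 2 * 2 ≡ suc m
  half*2 = m/n*n≡m 2∣n
  half>0 : 0 < suc m / 2
  half>0 = ℕₚ.n≢0⇒n>0 (λ half≡0 → ℕₚ.1+n≢0 (trans (sym half*2) (cong (_* 2) half≡0)))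
  half≤f : suc m / 2 ≤ f
  half≤f = ℕₚ.≤-pred (ℕₚ.≤-trans (m/n<m (suc m) 2 (s≤s (s≤s z≤n))) (s≤s m≤f))
  2^k∣half : 2 ^ k ∣ suc m / 2
  2^k∣half = *-cancelˡ-∣ 2 (subst (2 * 2 ^ k ∣_) (sym (trans (ℕₚ.*-comm 2 (suc m / 2)) half*2)) 2^[1+k]∣n)

twoPart-∣ : ∀ n → twoPart n ∣ n
twoPart-∣ n = v₂-∣ n n

2^k∣⇒2^k≤twoPart : ∀ {n} k → 0 < n → 2 ^ k ∣ n → 2 ^ k ≤ twoPart n
2^k∣⇒2^k≤twoPart {n} k n>0 2^k∣n = ℕₚ.^-monoʳ-≤ 2 (2^k∣⇒k≤v₂ n k n>0 ℕₚ.≤-refl 2^k∣n)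

2≤twoPart⇒2∣ : ∀ n → 2 ≤ twoPart n → 2 ∣ n
2≤twoPart⇒2∣ n 2≤twoPart = ∣-trans (2∣2^v (v₂ n n) 2≤twoPart) (twoPart-∣ n)
  where
  2∣2^v : ∀ v → 2 ≤ 2 ^ v → 2 ∣ 2 ^ v
  2∣2^v zero    (s≤s ())
  2∣2^v (suc v) _ = m∣m*n (2 ^ v)

term-vanishes : ∀ {ℓ d} → 0 < ℓ → d ∈ divisors ℓ → ¬ (twoPart d < twoPart ℓ ⊔ 2) → term ℓ d ≡ 0ℚ
term-vanishes {ℓ} {d} ℓ>0 d∈ d₂≮ = begin
  term ℓ d            ≡⟨ cong (fromℕ count ℚ.*_) (prodℚ-map-zero ratio (primesOnlyIn d c) 2∈ refl) ⟩
  fromℕ count ℚ.* 0ℚ  ≡⟨ ℚₚ.*-zeroʳ (fromℕ count) ⟩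
  0ℚ                  ∎
  where
  open ≡-Reasoning
  count = 2 ^ length (piLam' ℓ d) * φ d
  c = cofactor ℓ d
  d>0 = proj₁ (∈-divisors⁻ {n = ℓ} d∈)
  d∣ℓ = proj₂ (∈-divisors⁻ {n = ℓ} d∈)
  ℓ₂⊔2≤d₂ : twoPart ℓ ⊔ 2 ≤ twoPart d
  ℓ₂⊔2≤d₂ = ℕₚ.≮⇒≥ d₂≮
  2∣d : 2 ∣ d
  2∣d = 2≤twoPart⇒2∣ d (ℕₚ.≤-trans (ℕₚ.m≤n⊔m (twoPart ℓ) 2) ℓ₂⊔2≤d₂)
  2∤c : ¬ 2 ∣ c
  2∤c 2∣c = ℕₚ.<⇒≱ d₂<ℓ₂ (ℕₚ.≤-trans (ℕₚ.m≤m⊔n (twoPart ℓ) 2) ℓ₂⊔2≤d₂)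
    where
    2*d₂∣ℓ : 2 ^ suc (v₂ d d) ∣ ℓ
    2*d₂∣ℓ = subst (2 ^ suc (v₂ d d) ∣_) (cofactor*d≡ℓ d>0 d∣ℓ) (*-pres-∣ 2∣c (twoPart-∣ d))
    d₂<ℓ₂ : twoPart d < twoPart ℓ
    d₂<ℓ₂ = ℕₚ.<-≤-trans (ℕₚ.^-monoʳ-< 2 (s≤s (s≤s z≤n)) (ℕₚ.n<1+n (v₂ d d)))
                         (2^k∣⇒2^k≤twoPart (suc (v₂ d d)) ℓ>0 2*d₂∣ℓ)
  2∈ : 2 ∈ primesOnlyIn d c
  2∈ = ∈-primesOnlyIn⁺ d>0 prime[2] 2∣d 2∤c

rhs≡termSum : ∀ {ℓ} → 0 < ℓ → rhs ℓ ≡ termSum ℓ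
rhs≡termSum {ℓ} ℓ>0 = sumℚ-map-filter (λ d → twoPart d <? twoPart ℓ ⊔ 2) (term ℓ) (divisors ℓ) (term-vanishes ℓ>0)

-- Euler's totient

coprimeTo : ℕ → ℕ → ℕ
coprimeTo n k = indicator (coprime? k n)

φ-count : ∀ n → φ n ≡ sumBelow n (coprimeTo n ∘ suc)
φ-count n = trans (cong (length ∘ filter (λ k → coprime? k n)) (List.map-upTo suc n))
                  (length-filter-applyUpTo (λ k → coprime? k n) suc n)

sumBelow-coprimeTo : ∀ μ a → sumBelow (a * μ) (coprimeTo μ ∘ suc) ≡ a * φ μ
sumBelow-coprimeTo μ a = trans (sumBelow-periodic μ (coprimeTo μ ∘ suc) periodic a) (cong (a *_) (sym (φ-count μ)))
  where
  periodic : ∀ i → coprimeTo μ (suc (μ + i)) ≡ coprimeTo μ (suc i)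
  periodic i = indicator-⇔ (coprime? (suc (μ + i)) μ) (coprime? (suc i) μ)
    (λ ⊥μ {d} (d∣ , d∣μ) → ⊥μ (subst (d ∣_) (ℕₚ.+-suc μ i) (∣m∣n⇒∣m+n d∣μ d∣) , d∣μ))
    (λ ⊥μ {d} (d∣ , d∣μ) → ⊥μ (∣m+n∣m⇒∣n (subst (d ∣_) (sym (ℕₚ.+-suc μ i)) d∣) d∣μ , d∣μ))

-- The contribution of a prime power

module _ {p} (p-prime : Prime p) where

  private instance
    p-nonZero : NonZero p
    p-nonZero = prime⇒nonZero p-prime

  sumBelow-multiples-coprimeTo : ∀ {μ} → ¬ p ∣ μ → ∀ a →
    sumBelow (a * μ * p) (λ i → indicator (p ∣? suc i) * coprimeTo μ (suc i)) ≡ a * φ μ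
  sumBelow-multiples-coprimeTo {μ} p∤μ a = begin
    sumBelow (a * μ * p) (λ i → indicator (p ∣? suc i) * coprimeTo μ (suc i))
      ≡⟨ sumBelow-multiples p (a * μ) (coprimeTo μ) ⟩
    sumBelow (a * μ) (λ t → coprimeTo μ (p * suc t))
      ≡⟨ sumBelow-cong (a * μ) (λ t _ → scaled t) ⟩
    sumBelow (a * μ) (coprimeTo μ ∘ suc)
      ≡⟨ sumBelow-coprimeTo μ a ⟩
    a * φ μ ∎
    where
    open ≡-Reasoning
    scaled : ∀ t → coprimeTo μ (p * suc t) ≡ coprimeTo μ (suc t)
    scaled t = indicator-⇔ (coprime? (p * suc t) μ) (coprime? (suc t) μ)
      (λ pt⊥μ (d∣t , d∣μ) → pt⊥μ (∣-trans d∣t (n∣m*n p) , d∣μ))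
      (λ t⊥μ → Coprime.sym (coprime-* (prime∤⇒coprime p-prime p∤μ) (Coprime.sym t⊥μ)))

  -- Among the k ≤ p^(j+1) μ coprime to μ, those coprime to p are exactly those coprime to p^(j+1) μ.
  φ-p^[1+j]*μ+p^j*φ[μ] : ∀ {μ} → ¬ p ∣ μ → ∀ j → φ (p ^ suc j * μ) + p ^ j * φ μ ≡ p ^ suc j * φ μ
  φ-p^[1+j]*μ+p^j*φ[μ] {μ} p∤μ j = begin
    φ N + p ^ j * φ μ
      ≡⟨ cong₂ _+_ (φ-count N) (sym multiples) ⟩
    sumBelow N (coprimeTo N ∘ suc) + sumBelow N (λ i → indicator (p ∣? suc i) * coprimeTo μ (suc i))
      ≡⟨ sumBelow-distrib-+ N _ _ ⟨
    sumBelow N (λ i → coprimeTo N (suc i) + indicator (p ∣? suc i) * coprimeTo μ (suc i))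
      ≡⟨ sumBelow-cong N (λ i _ → split (suc i)) ⟨
    sumBelow N (coprimeTo μ ∘ suc)
      ≡⟨ sumBelow-coprimeTo μ (p ^ suc j) ⟩
    p ^ suc j * φ μ ∎
    where
    open ≡-Reasoning
    N = p ^ suc j * μ
    split : ∀ k → coprimeTo μ k ≡ coprimeTo N k + indicator (p ∣? k) * coprimeTo μ k
    split k = indicator-split (coprime? k N) (coprime? k μ) (p ∣? k)
      (λ k⊥N → coprime-∣ʳ k⊥N (n∣m*n (p ^ suc j)))
      (λ k⊥N p∣k → prime⇒≢1 p-prime (k⊥N (p∣k , p∣p^[1+j]*n p j μ)))
      (λ k⊥μ p∤k → coprime-* (prime∤⇒coprime-^ p-prime p∤k (suc j)) k⊥μ)
    multiples : sumBelow N (λ i → indicator (p ∣? suc i) * coprimeTo μ (suc i)) ≡ p ^ j * φ μ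
    multiples = trans (cong (λ n → sumBelow n (λ i → indicator (p ∣? suc i) * coprimeTo μ (suc i)))
                            (trans (ℕₚ.*-assoc p (p ^ j) μ) (ℕₚ.*-comm p (p ^ j * μ))))
                      (sumBelow-multiples-coprimeTo p∤μ (p ^ j))

  suc[p∸1]≡p : suc (p ∸ 1) ≡ p
  suc[p∸1]≡p = ℕₚ.suc-pred p

  φ-p^[1+j]*μ : ∀ {μ} → ¬ p ∣ μ → ∀ j → φ (p ^ suc j * μ) ≡ p ^ j * (p ∸ 1) * φ μ
  φ-p^[1+j]*μ {μ} p∤μ j = ℕₚ.+-cancelʳ-≡ (p ^ j * φ μ) _ _ (begin
    φ (p ^ suc j * μ) + p ^ j * φ μ              ≡⟨ φ-p^[1+j]*μ+p^j*φ[μ] p∤μ j ⟩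
    p * p ^ j * φ μ                              ≡⟨ cong (λ x → x * p ^ j * φ μ) suc[p∸1]≡p ⟨
    suc (p ∸ 1) * p ^ j * φ μ                    ≡⟨ distribute (p ^ j) (p ∸ 1) (φ μ) ⟩
    p ^ j * (p ∸ 1) * φ μ + p ^ j * φ μ          ∎)
    where
    open ≡-Reasoning
    distribute : ∀ a b c → suc b * a * c ≡ a * b * c + a * c
    distribute = solve-∀

  p∤1 : ¬ p ∣ 1
  p∤1 = prime⇒≢1 p-prime ∘ ∣1⇒≡1

  φ-p^[1+j] : ∀ j → φ (p ^ suc j) ≡ p ^ j * (p ∸ 1)
  φ-p^[1+j] j = begin
    φ (p ^ suc j)               ≡⟨ cong φ (ℕₚ.*-identityʳ (p ^ suc j)) ⟨
    φ (p ^ suc j * 1)           ≡⟨ φ-p^[1+j]*μ p∤1 j ⟩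
    p ^ j * (p ∸ 1) * 1         ≡⟨ ℕₚ.*-identityʳ (p ^ j * (p ∸ 1)) ⟩
    p ^ j * (p ∸ 1)             ∎
    where open ≡-Reasoning

  φ-p^j*μ : ∀ {μ} → ¬ p ∣ μ → ∀ j → φ (p ^ j * μ) ≡ φ (p ^ j) * φ μ
  φ-p^j*μ {μ} p∤μ zero    = trans (cong φ (ℕₚ.*-identityˡ μ)) (sym (ℕₚ.+-identityʳ (φ μ)))
  φ-p^j*μ {μ} p∤μ (suc j) = trans (φ-p^[1+j]*μ p∤μ j) (cong (_* φ μ) (sym (φ-p^[1+j] j)))

  sumBelow-φ-p^j : ∀ n → sumBelow (suc n) (λ j → φ (p ^ j)) ≡ p ^ n
  sumBelow-φ-p^j zero    = refl
  sumBelow-φ-p^j (suc n) = begin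
    sumBelow (suc (suc n)) (λ j → φ (p ^ j))                  ≡⟨ sumBelow-suc (suc n) (λ j → φ (p ^ j)) ⟩
    sumBelow (suc n) (λ j → φ (p ^ j)) + φ (p ^ suc n)        ≡⟨ cong₂ _+_ (sumBelow-φ-p^j n) (φ-p^[1+j] n) ⟩
    p ^ n + p ^ n * (p ∸ 1)                                   ≡⟨ collect (p ^ n) (p ∸ 1) ⟩
    suc (p ∸ 1) * p ^ n                                       ≡⟨ cong (_* p ^ n) suc[p∸1]≡p ⟩
    p ^ suc n                                                 ∎
    where
    open ≡-Reasoning
    collect : ∀ a b → a + a * b ≡ suc b * a
    collect = solve-∀

  p>1 : 1 < p
  p>1 = nonTrivial⇒n>1 p {{prime⇒nonTrivial p-prime}}

  p^j*n>0 : ∀ j {n} → 0 < n → 0 < p ^ j * n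
  p^j*n>0 j n>0 = ℕₚ.*-mono-< (ℕₚ.m^n>0 p j) n>0

  p-adic-decomposition : ∀ n → 0 < n → ∃₂ λ j μ → n ≡ p ^ j * μ × ¬ p ∣ μ
  p-adic-decomposition = <-rec _ decompose
    where
    decompose : ∀ n → (∀ {m} → m < n → 0 < m → ∃₂ λ j μ → m ≡ p ^ j * μ × ¬ p ∣ μ) →
                0 < n → ∃₂ λ j μ → n ≡ p ^ j * μ × ¬ p ∣ μ
    decompose n rec n>0 with p ∣? n
    ... | no  p∤n = 0 , n , sym (ℕₚ.*-identityˡ n) , p∤n
    ... | yes (divides q refl) =
      let instance q≢0 = ℕₚ.m*n≢0⇒m≢0 q {{>-nonZero n>0}}
          j , μ , q≡p^j*μ , p∤μ = rec (ℕₚ.m<m*n q p p>1) (>-nonZero⁻¹ q)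
      in suc j , μ , trans (cong (_* p) q≡p^j*μ) (rotate (p ^ j) μ p) , p∤μ
      where
      rotate : ∀ a b c → a * b * c ≡ c * a * b
      rotate = solve-∀

  p-adic-split : ∀ {n} → 0 < n → p ∣ n → ∃₂ λ e μ → n ≡ p ^ suc e * μ × ¬ p ∣ μ × 0 < μ × μ < n
  p-adic-split {n} n>0 p∣n with p-adic-decomposition n n>0
  ... | zero  , μ , refl , p∤μ = contradiction (subst (p ∣_) (ℕₚ.*-identityˡ μ) p∣n) p∤μ
  ... | suc e , μ , refl , p∤μ = e , μ , refl , p∤μ , μ>0 , μ<n
    where
    μ>0 : 0 < μ
    μ>0 = ∣⇒0< n>0 (n∣m*n (p ^ suc e))
    μ<n : μ < p ^ suc e * μ
    μ<n = subst (μ <_) (ℕₚ.*-comm μ (p ^ suc e))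
                (ℕₚ.m<m*n μ (p ^ suc e) {{>-nonZero μ>0}} (ℕₚ.^-monoʳ-< p p>1 {0} {suc e} z<s))

  p^j*μ-injective : ∀ {j j' μ μ'} → ¬ p ∣ μ → ¬ p ∣ μ' → p ^ j * μ ≡ p ^ j' * μ' → j ≡ j' × μ ≡ μ'
  p^j*μ-injective {zero}  {zero}            _   _    eq =
    refl , trans (sym (ℕₚ.*-identityˡ _)) (trans eq (ℕₚ.*-identityˡ _))
  p^j*μ-injective {zero}  {suc j'} {μ} {μ'} p∤μ _    eq =
    contradiction (subst (p ∣_) (trans (sym eq) (ℕₚ.*-identityˡ μ)) (p∣p^[1+j]*n p j' μ')) p∤μ
  p^j*μ-injective {suc j} {zero}   {μ} {μ'} _   p∤μ' eq =
    contradiction (subst (p ∣_) (trans eq (ℕₚ.*-identityˡ μ')) (p∣p^[1+j]*n p j μ)) p∤μ'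
  p^j*μ-injective {suc j} {suc j'} {μ} {μ'} p∤μ p∤μ' eq =
    let j≡j' , μ≡μ' = p^j*μ-injective p∤μ p∤μ' (ℕₚ.*-cancelˡ-≡ _ _ p
                        (trans (sym (ℕₚ.*-assoc p (p ^ j) μ)) (trans eq (ℕₚ.*-assoc p (p ^ j') μ'))))
    in cong suc j≡j' , μ≡μ'

  p^j∣p^e⇒j≤e : ∀ {j e} → p ^ j ∣ p ^ e → j ≤ e
  p^j∣p^e⇒j≤e {j} {e} p^j∣p^e =
    ℕₚ.≮⇒≥ (λ e<j → ℕₚ.<⇒≱ (ℕₚ.^-monoʳ-< p p>1 e<j) (∣⇒≤ {{ℕₚ.m^n≢0 p e}} p^j∣p^e))

  divisors-p^e*m : ∀ e {m} → 0 < m → ¬ p ∣ m →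
    divisors (p ^ e * m) ↭ map (uncurry λ j μ → p ^ j * μ) (cartesianProduct (upTo (suc e)) (divisors m))
  divisors-p^e*m e {m} m>0 p∤m = unique∧sameElements⇒↭ (Unique-divisors (p ^ e * m)) unique to from
    where
    pairs = cartesianProduct (upTo (suc e)) (divisors m)
    p^j*μ : ℕ × ℕ → ℕ
    p^j*μ = uncurry λ j μ → p ^ j * μ
    p∤divisor : ∀ {μ} → μ ∈ divisors m → ¬ p ∣ μ
    p∤divisor μ∈ p∣μ = p∤m (∣-trans p∣μ (proj₂ (∈-divisors⁻ {n = m} μ∈)))
    to : ∀ {d} → d ∈ divisors (p ^ e * m) → d ∈ map p^j*μ pairs
    to {d} d∈ with j , μ , refl , p∤μ ← p-adic-decomposition d (proj₁ (∈-divisors⁻ {n = p ^ e * m} d∈)) =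
      ∈-map⁺ p^j*μ (∈-cartesianProduct⁺ (∈-upTo⁺ (s≤s j≤e)) (∈-divisors⁺ m>0 μ∣m))
      where
      d∣ℓ = proj₂ (∈-divisors⁻ {n = p ^ e * m} d∈)
      μ∣m : μ ∣ m
      μ∣m = coprime-divisor (prime∤⇒coprime-^ p-prime p∤μ e) (∣-trans (n∣m*n (p ^ j)) d∣ℓ)
      j≤e : j ≤ e
      j≤e = p^j∣p^e⇒j≤e (coprime-divisor (Coprime.sym (prime∤⇒coprime-^ p-prime p∤m j))
                          (subst (p ^ j ∣_) (ℕₚ.*-comm (p ^ e) m) (∣-trans (m∣m*n μ) d∣ℓ)))
    from : ∀ {d} → d ∈ map p^j*μ pairs → d ∈ divisors (p ^ e * m)
    from d∈ with (j , μ) , jμ∈ , refl ← ∈-map⁻ p^j*μ d∈ =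
      let j∈ , μ∈ = ∈-cartesianProduct⁻ (upTo (suc e)) (divisors m) jμ∈
      in ∈-divisors⁺ (p^j*n>0 e m>0)
                     (*-pres-∣ (^-∣ p (ℕₚ.≤-pred (∈-upTo⁻ j∈))) (proj₂ (∈-divisors⁻ {n = m} μ∈)))
    unique : Unique (map p^j*μ pairs)
    unique = Unique-map⁺-local injective (Unique.cartesianProduct⁺ (Unique.upTo⁺ (suc e)) (Unique-divisors m))
      where
      injective : ∀ {x y} → x ∈ pairs → y ∈ pairs → p^j*μ x ≡ p^j*μ y → x ≡ y
      injective {j , μ} {j' , μ'} x∈ y∈ eq
        with refl , refl ← p^j*μ-injective {j} {j'} (p∤divisor (proj₂ (∈-cartesianProduct⁻ (upTo (suc e)) (divisors m) x∈)))
                                           (p∤divisor (proj₂ (∈-cartesianProduct⁻ (upTo (suc e)) (divisors m) y∈))) eq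
        = refl

  primeDivisors-p^[1+q]*c : ∀ q {c} → 0 < c → ¬ p ∣ c → primeDivisors (p ^ suc q * c) ↭ p ∷ primeDivisors c
  primeDivisors-p^[1+q]*c q {c} c>0 p∤c =
    unique∧sameElements⇒↭ (Unique-primeDivisors (p ^ suc q * c)) (p∉ ∷ Unique-primeDivisors c) to from
    where
    p∉ : All.All (p ≢_) (primeDivisors c)
    p∉ = All.tabulate λ x∈ p≡x → p∤c (subst (_∣ c) (sym p≡x) (proj₂ (∈-primeDivisors⁻ {n = c} x∈)))
    to : ∀ {x} → x ∈ primeDivisors (p ^ suc q * c) → x ∈ p ∷ primeDivisors c
    to {x} x∈ with x ≟ p | ∈-primeDivisors⁻ {n = p ^ suc q * c} x∈
    ... | yes refl | _             = here refl
    ... | no x≢p   | x-prime , x∣  = there (∈-primeDivisors⁺ c>0 x-prime (prime-∣-p^j*n (suc q) p-prime x-prime x≢p x∣))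
    from : ∀ {x} → x ∈ p ∷ primeDivisors c → x ∈ primeDivisors (p ^ suc q * c)
    from (here refl) = ∈-primeDivisors⁺ (p^j*n>0 (suc q) c>0) p-prime (p∣p^[1+j]*n p q c)
    from (there x∈)  = let x-prime , x∣c = ∈-primeDivisors⁻ {n = c} x∈
                       in ∈-primeDivisors⁺ (p^j*n>0 (suc q) c>0) x-prime (∣n⇒∣m*n (p ^ suc q) x∣c)

  primesOnlyIn-p^j*μ-p^[1+q]*c : ∀ j q {μ c} → 0 < μ → ¬ p ∣ μ →
    primesOnlyIn (p ^ j * μ) (p ^ suc q * c) ↭ primesOnlyIn μ c
  primesOnlyIn-p^j*μ-p^[1+q]*c j q {μ} {c} μ>0 p∤μ =
    unique∧sameElements⇒↭ (Unique-primesOnlyIn (p ^ j * μ) (p ^ suc q * c)) (Unique-primesOnlyIn μ c) to from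
    where
    to : ∀ {x} → x ∈ primesOnlyIn (p ^ j * μ) (p ^ suc q * c) → x ∈ primesOnlyIn μ c
    to {x} x∈ with x ≟ p | ∈-primesOnlyIn⁻ {d = p ^ j * μ} x∈
    ... | yes refl | _ , _ , p∤          = contradiction (p∣p^[1+j]*n p q c) p∤
    ... | no x≢p   | x-prime , x∣ , x∤   =
      ∈-primesOnlyIn⁺ μ>0 x-prime (prime-∣-p^j*n j p-prime x-prime x≢p x∣) (x∤ ∘ ∣n⇒∣m*n (p ^ suc q))
    from : ∀ {x} → x ∈ primesOnlyIn μ c → x ∈ primesOnlyIn (p ^ j * μ) (p ^ suc q * c)
    from {x} x∈ with x ≟ p | ∈-primesOnlyIn⁻ {d = μ} x∈
    ... | yes refl | _ , p∣μ , _         = contradiction p∣μ p∤μ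
    ... | no x≢p   | x-prime , x∣μ , x∤c =
      ∈-primesOnlyIn⁺ (p^j*n>0 j μ>0) x-prime (∣n⇒∣m*n (p ^ j) x∣μ) (x∤c ∘ prime-∣-p^j*n (suc q) p-prime x-prime x≢p)

  primesOnlyIn-p^[1+j]*μ : ∀ j {μ c} → 0 < μ → ¬ p ∣ μ → ¬ p ∣ c →
    primesOnlyIn (p ^ suc j * μ) c ↭ p ∷ primesOnlyIn μ c
  primesOnlyIn-p^[1+j]*μ j {μ} {c} μ>0 p∤μ p∤c =
    unique∧sameElements⇒↭ (Unique-primesOnlyIn (p ^ suc j * μ) c) (p∉ ∷ Unique-primesOnlyIn μ c) to from
    where
    p∉ : All.All (p ≢_) (primesOnlyIn μ c)
    p∉ = All.tabulate λ x∈ p≡x → p∤μ (subst (_∣ μ) (sym p≡x) (proj₁ (proj₂ (∈-primesOnlyIn⁻ {d = μ} x∈))))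
    to : ∀ {x} → x ∈ primesOnlyIn (p ^ suc j * μ) c → x ∈ p ∷ primesOnlyIn μ c
    to {x} x∈ with x ≟ p | ∈-primesOnlyIn⁻ {d = p ^ suc j * μ} x∈
    ... | yes refl | _                   = here refl
    ... | no x≢p   | x-prime , x∣ , x∤c  =
      there (∈-primesOnlyIn⁺ μ>0 x-prime (prime-∣-p^j*n (suc j) p-prime x-prime x≢p x∣) x∤c)
    from : ∀ {x} → x ∈ p ∷ primesOnlyIn μ c → x ∈ primesOnlyIn (p ^ suc j * μ) c
    from (here refl) = ∈-primesOnlyIn⁺ (p^j*n>0 (suc j) μ>0) p-prime (p∣p^[1+j]*n p j μ) p∤c
    from (there x∈)  = let x-prime , x∣μ , x∤c = ∈-primesOnlyIn⁻ {d = μ} x∈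
                       in ∈-primesOnlyIn⁺ (p^j*n>0 (suc j) μ>0) x-prime (∣n⇒∣m*n (p ^ suc j) x∣μ) x∤c

  summand-p^j*μ-p^[1+q]*c : ∀ j q {μ c} → 0 < μ → 0 < c → ¬ p ∣ μ → ¬ p ∣ c →
    summand (p ^ j * μ) (p ^ suc q * c) ≡ fromℕ (2 * φ (p ^ j)) ℚ.* summand μ c
  summand-p^j*μ-p^[1+q]*c j q {μ} {c} μ>0 c>0 p∤μ p∤c = begin
    fromℕ (2 ^ length (primeDivisors (p ^ suc q * c)) * φ (p ^ j * μ))
      ℚ.* prodℚ (map ratio (primesOnlyIn (p ^ j * μ) (p ^ suc q * c)))
      ≡⟨ cong₂ (λ n x → fromℕ n ℚ.* x) count≡
               (prodℚ-↭ (↭.map⁺ ratio (primesOnlyIn-p^j*μ-p^[1+q]*c j q μ>0 p∤μ))) ⟩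
    fromℕ (2 * φ (p ^ j) * (2 ^ K * φ μ)) ℚ.* P
      ≡⟨ cong (ℚ._* P) (fromℕ-homo-* (2 * φ (p ^ j)) (2 ^ K * φ μ)) ⟩
    fromℕ (2 * φ (p ^ j)) ℚ.* fromℕ (2 ^ K * φ μ) ℚ.* P
      ≡⟨ ℚₚ.*-assoc (fromℕ (2 * φ (p ^ j))) (fromℕ (2 ^ K * φ μ)) P ⟩
    fromℕ (2 * φ (p ^ j)) ℚ.* summand μ c ∎
    where
    open ≡-Reasoning
    K = length (primeDivisors c)
    P = prodℚ (map ratio (primesOnlyIn μ c))
    regroup : ∀ t a b → 2 * t * (a * b) ≡ 2 * a * (t * b)
    regroup = solve-∀
    count≡ : 2 ^ length (primeDivisors (p ^ suc q * c)) * φ (p ^ j * μ) ≡ 2 * φ (p ^ j) * (2 ^ K * φ μ)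
    count≡ = begin
      2 ^ length (primeDivisors (p ^ suc q * c)) * φ (p ^ j * μ)
        ≡⟨ cong₂ (λ k n → 2 ^ k * n) (↭.↭-length (primeDivisors-p^[1+q]*c q c>0 p∤c)) (φ-p^j*μ p∤μ j) ⟩
      2 * 2 ^ K * (φ (p ^ j) * φ μ)
        ≡⟨ regroup (2 ^ K) (φ (p ^ j)) (φ μ) ⟩
      2 * φ (p ^ j) * (2 ^ K * φ μ) ∎

  summand-p^[1+j]*μ : ∀ j {μ c} → 0 < μ → ¬ p ∣ μ → ¬ p ∣ c →
    summand (p ^ suc j * μ) c ≡ fromℕ (φ (p ^ suc j)) ℚ.* ratio p ℚ.* summand μ c
  summand-p^[1+j]*μ j {μ} {c} μ>0 p∤μ p∤c = begin
    fromℕ (2 ^ K * φ (p ^ suc j * μ)) ℚ.* prodℚ (map ratio (primesOnlyIn (p ^ suc j * μ) c))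
      ≡⟨ cong₂ (λ n x → fromℕ n ℚ.* x) count≡
               (prodℚ-↭ (↭.map⁺ ratio (primesOnlyIn-p^[1+j]*μ j μ>0 p∤μ p∤c))) ⟩
    fromℕ (φ (p ^ suc j) * (2 ^ K * φ μ)) ℚ.* (ratio p ℚ.* P)
      ≡⟨ cong (ℚ._* (ratio p ℚ.* P)) (fromℕ-homo-* (φ (p ^ suc j)) (2 ^ K * φ μ)) ⟩
    fromℕ (φ (p ^ suc j)) ℚ.* fromℕ (2 ^ K * φ μ) ℚ.* (ratio p ℚ.* P)
      ≡⟨ *-interchange (fromℕ (φ (p ^ suc j))) (fromℕ (2 ^ K * φ μ)) (ratio p) P ⟩
    fromℕ (φ (p ^ suc j)) ℚ.* ratio p ℚ.* summand μ c ∎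
    where
    open ≡-Reasoning
    open CommSemigroupProperties (CommutativeMonoid.commutativeSemigroup ℚₚ.*-1-commutativeMonoid)
      using () renaming (interchange to *-interchange)
    K = length (primeDivisors c)
    P = prodℚ (map ratio (primesOnlyIn μ c))
    swap : ∀ a b c → a * (b * c) ≡ b * (a * c)
    swap = solve-∀
    count≡ : 2 ^ K * φ (p ^ suc j * μ) ≡ φ (p ^ suc j) * (2 ^ K * φ μ)
    count≡ = trans (cong (2 ^ K *_) (φ-p^j*μ p∤μ (suc j))) (swap (2 ^ K) (φ (p ^ suc j)) (φ μ))

  coefficients-sum : ∀ e →
    sumℚ (map (λ j → fromℕ (2 * φ (p ^ j))) (upTo (suc e))) ℚ.+ fromℕ (φ (p ^ suc e)) ℚ.* ratio p ≡ fromℕ (p ^ suc e)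
  coefficients-sum e = begin
    sumℚ (map (λ j → fromℕ (2 * φ (p ^ j))) (upTo (suc e))) ℚ.+ fromℕ (φ (p ^ suc e)) ℚ.* ratio p
      ≡⟨ cong₂ ℚ._+_ lower top ⟩
    fromℕ (2 * p ^ e) ℚ.+ fromℕ (p ^ e * (p ∸ 2))
      ≡⟨ fromℕ-homo-+ (2 * p ^ e) (p ^ e * (p ∸ 2)) ⟨
    fromℕ (2 * p ^ e + p ^ e * (p ∸ 2))
      ≡⟨ cong fromℕ (trans (collect (p ^ e) (p ∸ 2)) (cong (_* p ^ e) (ℕₚ.m+[n∸m]≡n p>1))) ⟩
    fromℕ (p ^ suc e) ∎
    where
    open ≡-Reasoning
    collect : ∀ a b → 2 * a + a * b ≡ (2 + b) * a
    collect = solve-∀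
    lower : sumℚ (map (λ j → fromℕ (2 * φ (p ^ j))) (upTo (suc e))) ≡ fromℕ (2 * p ^ e)
    lower = trans (sumℚ-map-fromℕ-upTo (λ j → 2 * φ (p ^ j)) (suc e))
                  (cong fromℕ (trans (sumBelow-*ˡ 2 (suc e) (λ j → φ (p ^ j))) (cong (2 *_) (sumBelow-φ-p^j e))))
    top : fromℕ (φ (p ^ suc e)) ℚ.* ratio p ≡ fromℕ (p ^ e * (p ∸ 2))
    top = begin
      fromℕ (φ (p ^ suc e)) ℚ.* ratio p                ≡⟨ cong (λ n → fromℕ n ℚ.* ratio p) (φ-p^[1+j] e) ⟩
      fromℕ (p ^ e * (p ∸ 1)) ℚ.* ratio p              ≡⟨ cong (ℚ._* ratio p) (fromℕ-homo-* (p ^ e) (p ∸ 1)) ⟩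
      fromℕ (p ^ e) ℚ.* fromℕ (p ∸ 1) ℚ.* ratio p      ≡⟨ ℚₚ.*-assoc (fromℕ (p ^ e)) (fromℕ (p ∸ 1)) (ratio p) ⟩
      fromℕ (p ^ e) ℚ.* (fromℕ (p ∸ 1) ℚ.* ratio p)    ≡⟨ cong (fromℕ (p ^ e) ℚ.*_) (fromℕ[p∸1]*ratio[p] p) ⟩
      fromℕ (p ^ e) ℚ.* fromℕ (p ∸ 2)                  ≡⟨ fromℕ-homo-* (p ^ e) (p ∸ 2) ⟨
      fromℕ (p ^ e * (p ∸ 2))                          ∎

  module _ {m} (m>0 : 0 < m) (p∤m : ¬ p ∣ m) where

    module _ {μ} (μ∈ : μ ∈ divisors m) where

      private
        μ>0 = proj₁ (∈-divisors⁻ {n = m} μ∈)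
        μ∣m = proj₂ (∈-divisors⁻ {n = m} μ∈)
        c = cofactor m μ
        c*μ≡m : c * μ ≡ m
        c*μ≡m = cofactor*d≡ℓ μ>0 μ∣m
        c>0 : 0 < c
        c>0 = ∣⇒0< m>0 (cofactor-∣ μ>0 μ∣m)
        p∤μ : ¬ p ∣ μ
        p∤μ p∣μ = p∤m (∣-trans p∣μ μ∣m)
        p∤c : ¬ p ∣ c
        p∤c p∣c = p∤m (∣-trans p∣c (cofactor-∣ μ>0 μ∣m))

      term-p^e*m-p^j*μ : ∀ {e j} → j < e → term (p ^ e * m) (p ^ j * μ) ≡ fromℕ (2 * φ (p ^ j)) ℚ.* term m μ
      term-p^e*m-p^j*μ {e} {j} j<e = begin
        term (p ^ e * m) (p ^ j * μ)
          ≡⟨ term≡summand (p ^ e * m) (p ^ j * μ) ⟩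
        summand (p ^ j * μ) (cofactor (p ^ e * m) (p ^ j * μ))
          ≡⟨ cong (summand (p ^ j * μ)) cofactor≡ ⟩
        summand (p ^ j * μ) (p ^ suc q * c)
          ≡⟨ summand-p^j*μ-p^[1+q]*c j q μ>0 c>0 p∤μ p∤c ⟩
        fromℕ (2 * φ (p ^ j)) ℚ.* term m μ ∎
        where
        open ≡-Reasoning
        q = e ∸ suc j
        regroup : ∀ a b c d → a * c * (b * d) ≡ b * a * (c * d)
        regroup = solve-∀
        p^[1+q]*c*p^j*μ≡ℓ : p ^ suc q * c * (p ^ j * μ) ≡ p ^ e * m
        p^[1+q]*c*p^j*μ≡ℓ = begin
          p ^ suc q * c * (p ^ j * μ)   ≡⟨ regroup (p ^ suc q) (p ^ j) c μ ⟩
          p ^ j * p ^ suc q * (c * μ)   ≡⟨ cong₂ _*_ (ℕₚ.^-distribˡ-+-* p j (suc q)) (sym c*μ≡m) ⟨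
          p ^ (j + suc q) * m           ≡⟨ cong (λ k → p ^ k * m) (trans (ℕₚ.+-suc j q) (ℕₚ.m+[n∸m]≡n j<e)) ⟩
          p ^ e * m                     ∎
        cofactor≡ : cofactor (p ^ e * m) (p ^ j * μ) ≡ p ^ suc q * c
        cofactor≡ = cofactor-unique (p^j*n>0 j μ>0) p^[1+q]*c*p^j*μ≡ℓ

      term-p^[1+e]*m-p^[1+e]*μ : ∀ e →
        term (p ^ suc e * m) (p ^ suc e * μ) ≡ fromℕ (φ (p ^ suc e)) ℚ.* ratio p ℚ.* term m μ
      term-p^[1+e]*m-p^[1+e]*μ e = begin
        term (p ^ suc e * m) (p ^ suc e * μ)
          ≡⟨ term≡summand (p ^ suc e * m) (p ^ suc e * μ) ⟩
        summand (p ^ suc e * μ) (cofactor (p ^ suc e * m) (p ^ suc e * μ))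
          ≡⟨ cong (summand (p ^ suc e * μ)) cofactor≡ ⟩
        summand (p ^ suc e * μ) c
          ≡⟨ summand-p^[1+j]*μ e μ>0 p∤μ p∤c ⟩
        fromℕ (φ (p ^ suc e)) ℚ.* ratio p ℚ.* term m μ ∎
        where
        open ≡-Reasoning
        swap : ∀ a b c → a * (b * c) ≡ b * (a * c)
        swap = solve-∀
        c*p^[1+e]*μ≡ℓ : c * (p ^ suc e * μ) ≡ p ^ suc e * m
        c*p^[1+e]*μ≡ℓ = trans (swap c (p ^ suc e) μ) (cong (p ^ suc e *_) c*μ≡m)
        cofactor≡ : cofactor (p ^ suc e * m) (p ^ suc e * μ) ≡ c
        cofactor≡ = cofactor-unique (p^j*n>0 (suc e) μ>0) c*p^[1+e]*μ≡ℓ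

    layer : ℕ → ℕ → ℚ
    layer e j = sumℚ (map (λ μ → term (p ^ e * m) (p ^ j * μ)) (divisors m))

    termSum-p^e*m≡sum-layers : ∀ e → termSum (p ^ e * m) ≡ sumℚ (map (layer e) (upTo (suc e)))
    termSum-p^e*m≡sum-layers e = begin
      sumℚ (map (term ℓ) (divisors ℓ))
        ≡⟨ sumℚ-↭ (↭.map⁺ (term ℓ) (divisors-p^e*m e m>0 p∤m)) ⟩
      sumℚ (map (term ℓ) (map p^j*μ pairs))
        ≡⟨ cong sumℚ (List.map-∘ pairs) ⟨
      sumℚ (map (term ℓ ∘ p^j*μ) pairs)
        ≡⟨ sumℚ-cartesianProduct (λ j μ → term ℓ (p ^ j * μ)) (upTo (suc e)) (divisors m) ⟩
      sumℚ (map (layer e) (upTo (suc e))) ∎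
      where
      open ≡-Reasoning
      ℓ = p ^ e * m
      pairs = cartesianProduct (upTo (suc e)) (divisors m)
      p^j*μ : ℕ × ℕ → ℕ
      p^j*μ = uncurry λ j μ → p ^ j * μ

    layer-below : ∀ {e j} → j < e → layer e j ≡ fromℕ (2 * φ (p ^ j)) ℚ.* termSum m
    layer-below {j = j} j<e = trans (sumℚ-map-cong (divisors m) (λ μ∈ → term-p^e*m-p^j*μ μ∈ j<e))
                                    (sumℚ-map-*ˡ (fromℕ (2 * φ (p ^ j))) (term m) (divisors m))

    layer-top : ∀ e → layer (suc e) (suc e) ≡ fromℕ (φ (p ^ suc e)) ℚ.* ratio p ℚ.* termSum m
    layer-top e = trans (sumℚ-map-cong (divisors m) (λ μ∈ → term-p^[1+e]*m-p^[1+e]*μ μ∈ e))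
                        (sumℚ-map-*ˡ (fromℕ (φ (p ^ suc e)) ℚ.* ratio p) (term m) (divisors m))

    termSum-p^[1+e]*m : ∀ e → termSum (p ^ suc e * m) ≡ fromℕ (p ^ suc e) ℚ.* termSum m
    termSum-p^[1+e]*m e = begin
      termSum (p ^ suc e * m)
        ≡⟨ termSum-p^e*m≡sum-layers (suc e) ⟩
      sumℚ (map (layer (suc e)) (upTo (suc (suc e))))
        ≡⟨ cong (sumℚ ∘ map (layer (suc e))) (List.upTo-∷ʳ (suc e)) ⟨
      sumℚ (map (layer (suc e)) (upTo (suc e) ∷ʳ suc e))
        ≡⟨ cong sumℚ (List.map-++ (layer (suc e)) (upTo (suc e)) [ suc e ]) ⟩
      sumℚ (map (layer (suc e)) (upTo (suc e)) ∷ʳ layer (suc e) (suc e))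
        ≡⟨ sumℚ-∷ʳ (map (layer (suc e)) (upTo (suc e))) (layer (suc e) (suc e)) ⟩
      sumℚ (map (layer (suc e)) (upTo (suc e))) ℚ.+ layer (suc e) (suc e)
        ≡⟨ cong₂ ℚ._+_ lower-layers (layer-top e) ⟩
      a ℚ.* termSum m ℚ.+ b ℚ.* termSum m
        ≡⟨ ℚₚ.*-distribʳ-+ (termSum m) a b ⟨
      (a ℚ.+ b) ℚ.* termSum m
        ≡⟨ cong (ℚ._* termSum m) (coefficients-sum e) ⟩
      fromℕ (p ^ suc e) ℚ.* termSum m ∎
      where
      open ≡-Reasoning
      a = sumℚ (map (λ j → fromℕ (2 * φ (p ^ j))) (upTo (suc e)))
      b = fromℕ (φ (p ^ suc e)) ℚ.* ratio p
      lower-layers : sumℚ (map (layer (suc e)) (upTo (suc e))) ≡ a ℚ.* termSum m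
      lower-layers = trans (sumℚ-map-cong (upTo (suc e)) (λ j∈ → layer-below (∈-upTo⁻ j∈)))
                           (sumℚ-map-*ʳ (termSum m) (λ j → fromℕ (2 * φ (p ^ j))) (upTo (suc e)))

termSum≡ℓ : ∀ ℓ → 0 < ℓ → termSum ℓ ≡ fromℕ ℓ
termSum≡ℓ = <-rec _ induction
  where
  induction : ∀ ℓ → (∀ {n} → n < ℓ → 0 < n → termSum n ≡ fromℕ n) → 0 < ℓ → termSum ℓ ≡ fromℕ ℓ
  induction 1 _ _ = refl
  induction ℓ@(suc (suc _)) ih ℓ>0 =
    let p , p-prime , p∣ℓ                     = ∃-prime-divisor ℓ (s<s z<s)
        e , μ , ℓ≡p^[1+e]*μ , p∤μ , μ>0 , μ<ℓ = p-adic-split p-prime ℓ>0 p∣ℓ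
    in begin
      termSum ℓ                            ≡⟨ cong termSum ℓ≡p^[1+e]*μ ⟩
      termSum (p ^ suc e * μ)              ≡⟨ termSum-p^[1+e]*m p-prime μ>0 p∤μ e ⟩
      fromℕ (p ^ suc e) ℚ.* termSum μ      ≡⟨ cong (fromℕ (p ^ suc e) ℚ.*_) (ih μ<ℓ μ>0) ⟩
      fromℕ (p ^ suc e) ℚ.* fromℕ μ        ≡⟨ fromℕ-homo-* (p ^ suc e) μ ⟨
      fromℕ (p ^ suc e * μ)                ≡⟨ cong fromℕ ℓ≡p^[1+e]*μ ⟨
      fromℕ ℓ                              ∎
    where open ≡-Reasoning

mainTheorem3 : (ℓ : ℕ) → 0 < ℓ → fromℕ ℓ ≡ rhs ℓ
mainTheorem3 ℓ ℓ>0 = begin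
  fromℕ ℓ     ≡⟨ termSum≡ℓ ℓ ℓ>0 ⟨
  termSum ℓ   ≡⟨ rhs≡termSum ℓ>0 ⟨
  rhs ℓ       ∎
  where open ≡-Reasoning
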